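{- For any graph $G$, $h(G)\le h(L(G))\le h(T(G))$.
   Context: All graphs are simple, finite and connected. The line graph $L(G)$ has the edges of $G$ as vertices, two adjacent if and only if they share an endpoint in $G$. The total graph $T(G)$ has vertex set $V(G)\cup E(G)$, two elements being adjacent in $T(G)$ if and only if they are adjacent or incident in $G$ (two vertices adjacent in $G$, two edges sharing an endpoint, or a vertex and an edge incident to it). The primitive hole number $h(G)$ is the number of triangles (cycles $C_3$) in $G$, with $h(G)=0$ if there are none. -}

module Defs where

open import Data.Bool using (Bool; true; false; _∧_; _∨_; not)
open import Data.Bool.Properties using (∨-comm)
open import Data.Nat using (ℕ; _+_; _<ᵇ_)
open import Data.Fin using (Fin; toℕ; splitAt)
open import Data.Fin.Properties using (_≟_)
open import Data.List using (List; length; lookup; filterᵇ; cartesianProduct; allFin; concatMap; map)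
open import Data.Product using (_×_; _,_; proj₁; proj₂)
open import Data.Sum using (inj₁; inj₂)
open import Relation.Nullary using (yes; no)
open import Relation.Nullary.Decidable using (⌊_⌋)
open import Relation.Binary.PropositionalEquality using (_≡_; refl; sym; cong₂)

record Graph : Set where
  field
    n     : ℕ
    adj   : Fin n → Fin n → Bool
    adj-sym : ∀ i j → adj i j ≡ adj j i
    irref : ∀ i → adj i i ≡ false
open Graph public

data Reach (G : Graph) : Fin (n G) → Fin (n G) → Set where
  here : ∀ {i} → Reach G i i
  step : ∀ {i k j} → adj G i k ≡ true → Reach G k j → Reach G i j

Connected : Graph → Set
Connected G = ∀ i j → Reach G i j

_==_ : ∀ {m} → Fin m → Fin m → Bool
i == j = ⌊ i ≟ j ⌋

==-sym : ∀ {m} (i j : Fin m) → (i == j) ≡ (j == i)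
==-sym i j with i ≟ j | j ≟ i
... | yes _ | yes _ = refl
... | no _  | no _  = refl
... | yes p | no q  with q (sym p)
...   | ()
==-sym i j | no q | yes p with q (sym p)
...   | ()

==-refl : ∀ {m} (i : Fin m) → (i == i) ≡ true
==-refl i with i ≟ i
... | yes _ = refl
... | no q with q refl
...   | ()

mkGraph : (m : ℕ) → (Fin m → Fin m → Bool) → Graph
mkGraph m r = record
  { n = m
  ; adj = λ i j → not (i == j) ∧ (r i j ∨ r j i)
  ; adj-sym = λ i j → cong₂ (λ a b → not a ∧ b) (==-sym i j) (∨-comm (r i j) (r j i))
  ; irref = λ i → cong₂ (λ a b → not a ∧ b) (==-refl i) refl
  }

edges : (G : Graph) → List (Fin (n G) × Fin (n G))
edges G = filterᵇ (λ p → (toℕ (proj₁ p) <ᵇ toℕ (proj₂ p)) ∧ adj G (proj₁ p) (proj₂ p))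
                  (cartesianProduct (allFin (n G)) (allFin (n G)))

numEdges : Graph → ℕ
numEdges G = length (edges G)

edge : (G : Graph) → Fin (numEdges G) → Fin (n G) × Fin (n G)
edge G e = lookup (edges G) e

shareEnd : ∀ {m} → Fin m × Fin m → Fin m × Fin m → Bool
shareEnd (a , b) (c , d) = (a == c) ∨ (a == d) ∨ (b == c) ∨ (b == d)

incident : ∀ {m} → Fin m → Fin m × Fin m → Bool
incident v (a , b) = (v == a) ∨ (v == b)

lineGraph : Graph → Graph
lineGraph G = mkGraph (numEdges G) (λ e f → shareEnd (edge G e) (edge G f))

-- Total graph T(G): vertex set V(G) ⊎ E(G) encoded as Fin (n + |E|).
totalAdj : (G : Graph) → Fin (n G + numEdges G) → Fin (n G + numEdges G) → Bool
totalAdj G x y with splitAt (n G) x | splitAt (n G) y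
... | inj₁ u | inj₁ v = adj G u v
... | inj₂ e | inj₂ f = shareEnd (edge G e) (edge G f)
... | inj₁ u | inj₂ f = incident u (edge G f)
... | inj₂ e | inj₁ v = incident v (edge G e)

totalGraph : Graph → Graph
totalGraph G = mkGraph (n G + numEdges G) (totalAdj G)

triangles : (G : Graph) → List (Fin (n G) × Fin (n G) × Fin (n G))
triangles G =
  filterᵇ (λ { (i , j , k) → (toℕ i <ᵇ toℕ j) ∧ (toℕ j <ᵇ toℕ k)
                             ∧ adj G i j ∧ adj G j k ∧ adj G i k })
          (cartesianProduct (allFin (n G)) (cartesianProduct (allFin (n G)) (allFin (n G))))

-- primitive hole number h(G) = number of triangles
h : Graph → ℕ
h G = length (triangles G)

-- h(G) is the length of the duplicate-free list of triangles of G, so both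
-- inequalities are proved by injecting one list of triangles into the other
-- (a pigeonhole principle for lists, obtained from the one for Fin).
--
-- h(G) ≤ h(L(G)):  a triangle i < j < k of G yields the three edges ij, ik, jk,
-- which pairwise share an endpoint.  The edge list of G is sorted
-- lexicographically and ij < ik < jk in that order, so their positions in the
-- edge list form a triangle of L(G) with increasing vertices.  The triangle
-- i j k is recovered from the first two of these edges, so the map is injective.
--
-- h(L(G)) ≤ h(T(G)):  the vertices of L(G) are the edge-vertices of T(G),
-- placed after the vertices of G in an order- and adjacency-preserving way.
-- Any injective, order- and adjacency-preserving map of vertices sends
-- triangles injectively to triangles, which gives the second inequality.

module Submission where

open import Defs
open import Data.Nat using (_≤_)
open import Data.Product using (_×_)
open import Data.Bool using (T; _∨_)
open import Data.Bool.Properties using (T-∧; T-∨)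
open import Data.Empty using (⊥-elim)
open import Data.Fin using (Fin; zero; suc; _<_; _↑ʳ_)
open import Data.Fin.Properties
  using (<-asym; <-resp₂-≡; <-trans; <⇒≢; injective⇒≤; toℕ-↑ʳ; ↑ʳ-injective; splitAt-↑ʳ)
open import Data.List using (List; []; _∷_; length; lookup; cartesianProduct; allFin; map)
open import Data.List.Membership.Propositional using (_∈_)
open import Data.List.Membership.Propositional.Properties
  using (∈-lookup; ∈-filter⁺; ∈-filter⁻; ∈-cartesianProduct⁺; ∈-cartesianProduct⁻; ∈-allFin; ∈-map⁻)
open import Data.List.Membership.Setoid.Properties using (index-injective)
import Data.List.Relation.Unary.All as All
open import Data.List.Relation.Unary.AllPairs as AllPairs using (AllPairs; []; _∷_)
import Data.List.Relation.Unary.AllPairs.Properties as AllPairsₚ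
open import Data.List.Relation.Unary.Any using (here; there; index)
open import Data.List.Relation.Unary.Any.Properties using (lookup-index)
open import Data.List.Relation.Unary.Unique.Propositional using (Unique)
import Data.List.Relation.Unary.Unique.Propositional.Properties as Unique
open import Data.Nat using (z<s; s<s)
open import Data.Nat.Properties using (<ᵇ⇒<; <⇒<ᵇ; +-monoʳ-<)
open import Data.Product using (_,_; proj₁; proj₂)
open import Data.Product.Relation.Binary.Lex.Strict using (×-Lex; ×-asymmetric)
open import Data.Sum using (inj₁; inj₂)
open import Function using (_∘_; Injective)
open import Function.Bundles using (Equivalence)
open import Level using (0ℓ)
open import Relation.Binary using (Rel; Asymmetric)
open import Relation.Binary.PropositionalEquality
  using (_≡_; refl; sym; cong; subst₂; setoid; module ≡-Reasoning)
open import Relation.Nullary.Decidable using (fromWitness; fromWitnessFalse; toWitnessFalse)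

open Equivalence using (to; from)

lookup-injective : ∀ {A : Set} {xs : List A} → Unique xs →
  ∀ {i j} → lookup xs i ≡ lookup xs j → i ≡ j
lookup-injective (_ ∷ _)          {zero}  {zero}  _     = refl
lookup-injective (x∉xs ∷ _)       {zero}  {suc j} x≡xⱼ = ⊥-elim (All.lookup x∉xs (∈-lookup j) x≡xⱼ)
lookup-injective (x∉xs ∷ _)       {suc i} {zero}  xᵢ≡x = ⊥-elim (All.lookup x∉xs (∈-lookup i) (sym xᵢ≡x))
lookup-injective (_ ∷ uniqueTail) {suc i} {suc j} xᵢ≡xⱼ =
  cong suc (lookup-injective uniqueTail xᵢ≡xⱼ)

length-≤-by-injection : ∀ {A B : Set} {xs : List A} {ys : List B} → Unique xs →
  (f : ∀ {x} → x ∈ xs → B) →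
  (∀ {x y} (x∈xs : x ∈ xs) (y∈xs : y ∈ xs) → f x∈xs ≡ f y∈xs → x ≡ y) →
  (∀ {x} (x∈xs : x ∈ xs) → f x∈xs ∈ ys) →
  length xs ≤ length ys
length-≤-by-injection {xs = xs} {ys = ys} unique f f-injective f∈ys =
  injective⇒≤ {f = position} position-injective
  where
  position : Fin (length xs) → Fin (length ys)
  position i = index (f∈ys (∈-lookup i))

  position-injective : Injective _≡_ _≡_ position
  position-injective eq = lookup-injective unique
    (f-injective _ _ (index-injective (setoid _) (f∈ys _) (f∈ys _) eq))

index-monotone : ∀ {A : Set} {ℓ} {R : Rel A ℓ} → Asymmetric R →
  ∀ {xs x y} → AllPairs R xs → (x∈xs : x ∈ xs) (y∈xs : y ∈ xs) → R x y →
  index x∈xs < index y∈xs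
index-monotone asym (_ ∷ _)      (here refl)  (here refl)  Rxx = ⊥-elim (asym Rxx Rxx)
index-monotone asym (_ ∷ _)      (here refl)  (there _)    _   = z<s
index-monotone asym (x≺ ∷ _)     (there x∈xs) (here refl)  Rxy = ⊥-elim (asym Rxy (All.lookup x≺ x∈xs))
index-monotone asym (_ ∷ sorted) (there x∈xs) (there y∈xs) Rxy =
  s<s (index-monotone asym sorted x∈xs y∈xs Rxy)

cartesianProduct-sorted : ∀ {A B : Set} {ℓ ℓ′} {R : Rel A ℓ} {S : Rel B ℓ′} {xs ys} →
  AllPairs R xs → AllPairs S ys → AllPairs (×-Lex _≡_ R S) (cartesianProduct xs ys)
cartesianProduct-sorted {xs = []} _ _ = []
cartesianProduct-sorted {R = R} {S} {x ∷ xs} {ys} (x≺xs ∷ xs-sorted) ys-sorted =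
  AllPairsₚ.++⁺ row-sorted (cartesianProduct-sorted xs-sorted ys-sorted)
    (All.tabulate λ p∈row → All.tabulate λ q∈rest → row-before-rest p∈row q∈rest)
  where
  row-sorted : AllPairs (×-Lex _≡_ R S) (map (x ,_) ys)
  row-sorted = AllPairsₚ.map⁺ (AllPairs.map (λ Syy′ → inj₂ (refl , Syy′)) ys-sorted)

  row-before-rest : ∀ {p q} → p ∈ map (x ,_) ys → q ∈ cartesianProduct xs ys → ×-Lex _≡_ R S p q
  row-before-rest p∈row q∈rest with ∈-map⁻ (x ,_) p∈row
  ... | _ , _ , refl = inj₁ (All.lookup x≺xs (proj₁ (∈-cartesianProduct⁻ xs ys q∈rest)))

Adj : (G : Graph) → Fin (n G) → Fin (n G) → Set
Adj G i j = T (adj G i j)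

record IsTriangle (G : Graph) (i j k : Fin (n G)) : Set where
  field
    i<j : i < j
    j<k : j < k
    ij  : Adj G i j
    jk  : Adj G j k
    ik  : Adj G i k

module _ (G : Graph) where

  private
    vertexTriples : List (Fin (n G) × Fin (n G) × Fin (n G))
    vertexTriples = cartesianProduct (allFin (n G)) (cartesianProduct (allFin (n G)) (allFin (n G)))

  triangles-unique : Unique (triangles G)
  triangles-unique = Unique.filter⁺ _
    (Unique.cartesianProduct⁺ (Unique.allFin⁺ _)
      (Unique.cartesianProduct⁺ (Unique.allFin⁺ _) (Unique.allFin⁺ _)))

  ∈-triangles⁻ : ∀ {i j k} → (i , j , k) ∈ triangles G → IsTriangle G i j k
  ∈-triangles⁻ t∈ =
    let ij<   , rest₁ = to T-∧ (proj₂ (∈-filter⁻ _ {xs = vertexTriples} t∈))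
        jk<   , rest₂ = to T-∧ rest₁
        ij    , rest₃ = to T-∧ rest₂
        jk    , ik    = to T-∧ rest₃
    in record { i<j = <ᵇ⇒< _ _ ij< ; j<k = <ᵇ⇒< _ _ jk< ; ij = ij ; jk = jk ; ik = ik }

  ∈-triangles⁺ : ∀ {i j k} → IsTriangle G i j k → (i , j , k) ∈ triangles G
  ∈-triangles⁺ {i} {j} {k} t = ∈-filter⁺ _
    (∈-cartesianProduct⁺ (∈-allFin i) (∈-cartesianProduct⁺ (∈-allFin j) (∈-allFin k)))
    (from T-∧ (<⇒<ᵇ i<j , from T-∧ (<⇒<ᵇ j<k , from T-∧ (ij , from T-∧ (jk , ik)))))
    where open IsTriangle t

h-≤-by-embedding : (G H : Graph) (φ : Fin (n G) → Fin (n H)) → Injective _≡_ _≡_ φ →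
  (∀ {i j} → i < j → φ i < φ j) → (∀ {i j} → Adj G i j → Adj H (φ i) (φ j)) →
  h G ≤ h H
h-≤-by-embedding G H φ φ-injective φ-monotone φ-adjacent =
  length-≤-by-injection (triangles-unique G) (λ {t} _ → image t) image-injective image∈
  where
  image : Fin (n G) × Fin (n G) × Fin (n G) → Fin (n H) × Fin (n H) × Fin (n H)
  image (i , j , k) = φ i , φ j , φ k

  image-injective : ∀ {s t} → s ∈ triangles G → t ∈ triangles G → image s ≡ image t → s ≡ t
  image-injective _ _ eq
    with φ-injective (cong proj₁ eq) | φ-injective (cong (proj₁ ∘ proj₂) eq)
       | φ-injective (cong (proj₂ ∘ proj₂) eq)
  ... | refl | refl | refl = refl

  image∈ : ∀ {t} → t ∈ triangles G → image t ∈ triangles H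
  image∈ t∈ = ∈-triangles⁺ H record
    { i<j = φ-monotone i<j ; j<k = φ-monotone j<k
    ; ij = φ-adjacent ij ; jk = φ-adjacent jk ; ik = φ-adjacent ik }
    where open IsTriangle (∈-triangles⁻ G t∈)

_<ₗₑₓ_ : ∀ {m} → Rel (Fin m × Fin m) 0ℓ
_<ₗₑₓ_ = ×-Lex _≡_ _<_ _<_

<ₗₑₓ-asym : ∀ {m} → Asymmetric (_<ₗₑₓ_ {m})
<ₗₑₓ-asym = ×-asymmetric {_≈₁_ = _≡_} {_<₁_ = _<_} {_<₂_ = _<_} sym <-resp₂-≡ <-asym <-asym

module _ {m} (i j k : Fin m) where

  private
    same : ∀ (v : Fin m) → T (v == v)
    same v = fromWitness refl

    skip : ∀ x {y} → T y → T (x ∨ y)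
    skip x = from (T-∨ {x}) ∘ inj₂

  shareEnd-ij-ik : T (shareEnd (i , j) (i , k))
  shareEnd-ij-ik = from T-∨ (inj₁ (same i))

  shareEnd-ij-jk : T (shareEnd (i , j) (j , k))
  shareEnd-ij-jk = skip (i == j) (skip (i == k) (from T-∨ (inj₁ (same j))))

  shareEnd-ik-jk : T (shareEnd (i , k) (j , k))
  shareEnd-ik-jk = skip (i == j) (skip (i == k) (skip (k == j) (same k)))

module _ (G : Graph) where

  edges-sorted : AllPairs _<ₗₑₓ_ (edges G)
  edges-sorted = AllPairsₚ.filter⁺ _ (cartesianProduct-sorted allFin-sorted allFin-sorted)
    where
    allFin-sorted : AllPairs _<_ (allFin (n G))
    allFin-sorted = AllPairsₚ.tabulate⁺-< (λ i<j → i<j)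

  ∈-edges⁺ : ∀ {i j} → i < j → Adj G i j → (i , j) ∈ edges G
  ∈-edges⁺ {i} {j} i<j ij =
    ∈-filter⁺ _ (∈-cartesianProduct⁺ (∈-allFin i) (∈-allFin j)) (from T-∧ (<⇒<ᵇ i<j , ij))

  edgeIndex : ∀ {i j} → i < j → Adj G i j → Fin (numEdges G)
  edgeIndex i<j ij = index (∈-edges⁺ i<j ij)

  edge-edgeIndex : ∀ {i j} (i<j : i < j) (ij : Adj G i j) → edge G (edgeIndex i<j ij) ≡ (i , j)
  edge-edgeIndex i<j ij = sym (lookup-index (∈-edges⁺ i<j ij))

  edgeIndex-monotone : ∀ {i j k l} (i<j : i < j) (ij : Adj G i j) (k<l : k < l) (kl : Adj G k l) →
    (i , j) <ₗₑₓ (k , l) → edgeIndex i<j ij < edgeIndex k<l kl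
  edgeIndex-monotone i<j ij k<l kl =
    index-monotone <ₗₑₓ-asym edges-sorted (∈-edges⁺ i<j ij) (∈-edges⁺ k<l kl)

  lineGraph-adj : ∀ {e f p q} → e < f → edge G e ≡ p → edge G f ≡ q → T (shareEnd p q) →
    Adj (lineGraph G) e f
  lineGraph-adj e<f refl refl shared = from T-∧ (fromWitnessFalse (<⇒≢ e<f) , from T-∨ (inj₁ shared))

  lineTriangle : ∀ {i j k} → IsTriangle G i j k →
    Fin (numEdges G) × Fin (numEdges G) × Fin (numEdges G)
  lineTriangle t = edgeIndex i<j ij , edgeIndex (<-trans i<j j<k) ik , edgeIndex j<k jk
    where open IsTriangle t

  lineTriangle-isTriangle : ∀ {i j k} (t : IsTriangle G i j k) →
    let (e₁ , e₂ , e₃) = lineTriangle t in IsTriangle (lineGraph G) e₁ e₂ e₃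
  lineTriangle-isTriangle {i} {j} {k} t = record
    { i<j = ij<ik
    ; j<k = ik<jk
    ; ij  = lineGraph-adj ij<ik (edge-edgeIndex i<j ij) (edge-edgeIndex i<k ik) (shareEnd-ij-ik i j k)
    ; jk  = lineGraph-adj ik<jk (edge-edgeIndex i<k ik) (edge-edgeIndex j<k jk) (shareEnd-ik-jk i j k)
    ; ik  = lineGraph-adj (<-trans ij<ik ik<jk) (edge-edgeIndex i<j ij) (edge-edgeIndex j<k jk)
                          (shareEnd-ij-jk i j k)
    }
    where
    open IsTriangle t
    i<k : i < k
    i<k = <-trans i<j j<k

    ij<ik : edgeIndex i<j ij < edgeIndex i<k ik
    ij<ik = edgeIndex-monotone i<j ij i<k ik (inj₂ (refl , j<k))

    ik<jk : edgeIndex i<k ik < edgeIndex j<k jk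
    ik<jk = edgeIndex-monotone i<k ik j<k jk (inj₁ i<j)

  triangleOfEdges : Fin (numEdges G) × Fin (numEdges G) × Fin (numEdges G) →
    Fin (n G) × Fin (n G) × Fin (n G)
  triangleOfEdges (e₁ , e₂ , _) = proj₁ (edge G e₁) , proj₂ (edge G e₁) , proj₂ (edge G e₂)

  triangleOfEdges-lineTriangle : ∀ {i j k} (t : IsTriangle G i j k) →
    triangleOfEdges (lineTriangle t) ≡ (i , j , k)
  triangleOfEdges-lineTriangle record { i<j = i<j ; j<k = j<k ; ij = ij ; ik = ik }
    rewrite edge-edgeIndex i<j ij | edge-edgeIndex (<-trans i<j j<k) ik = refl

  h≤h-lineGraph : h G ≤ h (lineGraph G)
  h≤h-lineGraph = length-≤-by-injection (triangles-unique G)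
    (lineTriangle ∘ ∈-triangles⁻ G) injective
    (∈-triangles⁺ (lineGraph G) ∘ lineTriangle-isTriangle ∘ ∈-triangles⁻ G)
    where
    injective : ∀ {s t} (s∈ : s ∈ triangles G) (t∈ : t ∈ triangles G) →
      lineTriangle (∈-triangles⁻ G s∈) ≡ lineTriangle (∈-triangles⁻ G t∈) → s ≡ t
    injective s∈ t∈ eq = begin
      _                                                 ≡⟨ sym (triangleOfEdges-lineTriangle (∈-triangles⁻ G s∈)) ⟩
      triangleOfEdges (lineTriangle (∈-triangles⁻ G s∈)) ≡⟨ cong triangleOfEdges eq ⟩
      triangleOfEdges (lineTriangle (∈-triangles⁻ G t∈)) ≡⟨ triangleOfEdges-lineTriangle (∈-triangles⁻ G t∈) ⟩
      _                                                 ∎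
      where open ≡-Reasoning

module _ (G : Graph) where

  totalAdj-edgeVertices : ∀ e f → totalAdj G (n G ↑ʳ e) (n G ↑ʳ f) ≡ shareEnd (edge G e) (edge G f)
  totalAdj-edgeVertices e f
    rewrite splitAt-↑ʳ (n G) (numEdges G) e | splitAt-↑ʳ (n G) (numEdges G) f = refl

  edgeVertex-monotone : ∀ {e f : Fin (numEdges G)} → e < f → (n G ↑ʳ e) < (n G ↑ʳ f)
  edgeVertex-monotone {e} {f} e<f rewrite toℕ-↑ʳ (n G) e | toℕ-↑ʳ (n G) f = +-monoʳ-< (n G) e<f

  edgeVertex-adj : ∀ {e f} → Adj (lineGraph G) e f → Adj (totalGraph G) (n G ↑ʳ e) (n G ↑ʳ f)
  edgeVertex-adj {e} {f} ef =
    let e≢f , shared = to T-∧ ef in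
    from T-∧ ( fromWitnessFalse (toWitnessFalse e≢f ∘ ↑ʳ-injective (n G) e f)
             , subst₂ (λ a b → T (a ∨ b))
                 (sym (totalAdj-edgeVertices e f)) (sym (totalAdj-edgeVertices f e)) shared)

  h-lineGraph≤h-totalGraph : h (lineGraph G) ≤ h (totalGraph G)
  h-lineGraph≤h-totalGraph = h-≤-by-embedding (lineGraph G) (totalGraph G) (n G ↑ʳ_)
    (↑ʳ-injective (n G) _ _) edgeVertex-monotone edgeVertex-adj

lemma2p7 : (G : Graph) → Connected G →
    (h G ≤ h (lineGraph G)) × (h (lineGraph G) ≤ h (totalGraph G))
lemma2p7 G _ = h≤h-lineGraph G , h-lineGraph≤h-totalGraph G
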